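{- Let $G$ be a finite simple graph. Then there is a unique set $X\subseteq V(G)$ such that, writing $X^c=V(G)\setminus X$: (1) $\alpha(G)=\alpha(G[X])+\alpha(G[X^c])$; (2) $G[X]$ is totally independence reducible, i.e. $\alpha'(G[X])=\alpha(G[X])$; (3) $G[X^c]$ is independence irreducible, i.e. $\alpha'(G[X^c])=0$; (4) for every maximum critical independent set $J_c$ of $G$, $X=J_c\cup N(J_c)$.
   Context: All graphs are finite and simple. For a graph $H$ and $S\subseteq V(H)$, $N_H(S)=\bigcup_{u\in S}N_H(u)$ is the set of neighbors of $S$ in $H$ (written $N(S)$ when $H$ is clear); $H[S]$ is the subgraph induced by $S$, and neighborhoods in an induced subgraph are computed within that subgraph. $\alpha(H)$ is the independence number of $H$. An independent set $I_c$ of $H$ is a critical independent set if $|I_c|-|N_H(I_c)|\ge |J|-|N_H(J)|$ for every independent set $J$ of $H$ (the empty set is independent). A maximum critical independent set is a critical independent set of maximum cardinality, and the critical independence number $\alpha'(H)$ is its cardinality. $H$ is totally independence reducible if $\alpha'(H)=\alpha(H)$, and independence irreducible if $\alpha'(H)=0$. -}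

module Defs where

open import Data.Nat using (ℕ; _≤_; _+_)
open import Data.Integer using (ℤ; +_; _-_) renaming (_≤_ to _≤ℤ_)
open import Data.Bool using (Bool; true; false)
import Data.Bool as B
open import Data.Fin using (Fin)
open import Data.Fin.Subset using (Subset; _∈_; _⊆_; ∣_∣; _∩_; _∪_; ∁; ⊤)
open import Data.Fin.Subset.Properties using (_∈?_)
open import Data.Fin.Properties using (any?)
open import Data.Vec using (tabulate)
open import Data.Product using (Σ; ∃; _×_; _,_)
open import Relation.Nullary using (does)
open import Relation.Nullary.Decidable using (_×-dec_)
open import Relation.Binary.PropositionalEquality using (_≡_)

record Graph (n : ℕ) : Set where
  field
    E       : Fin n → Fin n → Bool
    E-sym   : ∀ u v → E u v ≡ E v u
    E-irref : ∀ v → E v v ≡ false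
open Graph public

module _ {n : ℕ} (G : Graph n) where

  N : Subset n → Subset n
  N J = tabulate (λ v → does (any? (λ u → (u ∈? J) ×-dec (E G u v B.≟ true))))

  Independent : Subset n → Set
  Independent J = ∀ u v → u ∈ J → v ∈ J → E G u v ≡ false

  -- Notions in the induced subgraph G[S]: a vertex set J of G[S] is a
  -- subset J ⊆ S, and N_{G[S]}(J) = N_G(J) ∩ S.
  IndepIn : Subset n → Subset n → Set
  IndepIn S J = J ⊆ S × Independent J

  NIn : Subset n → Subset n → Subset n
  NIn S J = N J ∩ S

  surplus : Subset n → Subset n → ℤ
  surplus S J = + ∣ J ∣ - + ∣ NIn S J ∣

  Critical : Subset n → Subset n → Set
  Critical S J = IndepIn S J × (∀ K → IndepIn S K → surplus S K ≤ℤ surplus S J)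

  MaxCritical : Subset n → Subset n → Set
  MaxCritical S J = Critical S J × (∀ K → Critical S K → ∣ K ∣ ≤ ∣ J ∣)

  IsAlpha : Subset n → ℕ → Set
  IsAlpha S k = (∃ λ J → IndepIn S J × ∣ J ∣ ≡ k) × (∀ J → IndepIn S J → ∣ J ∣ ≤ k)

  IsCritAlpha : Subset n → ℕ → Set
  IsCritAlpha S k = ∃ λ J → MaxCritical S J × ∣ J ∣ ≡ k

  Decomposition : Subset n → Set
  Decomposition X =
      (∀ a b c → IsAlpha ⊤ a → IsAlpha X b → IsAlpha (∁ X) c → a ≡ b + c)
    × (∀ k → IsAlpha X k → IsCritAlpha X k)
    × IsCritAlpha (∁ X) 0
    × (∀ Jc → MaxCritical ⊤ Jc → X ≡ Jc ∪ N Jc)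

-- Write σ(J) = |J| - |N(J)| for the surplus of an independent set J; critical
-- sets are those of maximum surplus.
-- A maximum critical independent set I exists: maximise σ over the finitely
-- many independent sets, then maximise the size.  For X = I ∪ N(I), Hall's
-- condition makes I both a maximum independent set and a maximum critical
-- independent set of G[X] (condition (2)); every independent K of G[X^c] has
-- |K| ≤ |N(K) ∩ X^c|, with equality only for K = ∅, since otherwise I ∪ K would
-- beat I (conditions (1) and (3)); condition (4) is the closure inclusion in
-- both directions, and (4) alone forces uniqueness of X.

module Submission where

open import Defs
open import Data.Nat using (ℕ; zero; suc; _+_; _≤_; s≤s⁻¹)
open import Data.Nat.Properties
open import Data.Nat.Tactic.RingSolver using (solve-∀)
open import Data.Bool using (true; false)
open import Data.Bool.Properties using (¬-not)
import Data.Bool as B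
open import Data.Fin.Subset using (Subset; _∈_; _∉_; _⊆_; ∣_∣; _∩_; _∪_; ∁; ⊤; ⊥)
open import Data.Fin.Subset.Properties
open import Data.Fin.Properties using (any?; all?)
open import Data.Vec using ([]; _∷_; here; there)
open import Data.Vec.Properties using (lookup∘tabulate; []=⇒lookup; lookup⇒[]=)
open import Data.List using (List; map; _++_; filter)
import Data.List as L
open import Data.List.Membership.Propositional using () renaming (_∈_ to _∈ᴸ_)
open import Data.List.Membership.Propositional.Properties using (∈-map⁺; ∈-++⁺ˡ; ∈-++⁺ʳ; ∈-filter⁺)
open import Data.List.Relation.Unary.Any using (here)
import Data.List.Relation.Unary.All as All
open import Data.List.Relation.Unary.All.Properties using (all-filter)
import Data.List.Extrema
import Data.List.Extrema.Nat as ℕ-Extrema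
open import Data.Product using (∃; _×_; _,_; proj₁; proj₂)
open import Data.Sum using (inj₁; inj₂)
open import Data.Empty using (⊥-elim)
open import Relation.Nullary using (Dec; yes; no; does)
open import Relation.Nullary.Decidable using (_×-dec_; _→-dec_; dec-true)
open import Relation.Binary.PropositionalEquality
open import Data.Integer using (ℤ; _-_; -_; +≤+) renaming (_≤_ to _≤ℤ_; _+_ to _+ℤ_; +_ to ι; _≤?_ to _≤ℤ?_)
import Data.Integer.Properties as ℤP
open import Data.Integer.Tactic.RingSolver using () renaming (solve-∀ to ℤ-solve-∀)

private
  module ℤ-Extrema = Data.List.Extrema ℤP.≤-totalOrder

card-∪+∩ : ∀ {n} (A B : Subset n) → ∣ A ∪ B ∣ + ∣ A ∩ B ∣ ≡ ∣ A ∣ + ∣ B ∣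
card-∪+∩ [] [] = refl
card-∪+∩ (true ∷ A) (true ∷ B) =
  cong suc (trans (+-suc _ _) (trans (cong suc (card-∪+∩ A B)) (sym (+-suc _ _))))
card-∪+∩ (true ∷ A) (false ∷ B) = cong suc (card-∪+∩ A B)
card-∪+∩ (false ∷ A) (true ∷ B) = trans (cong suc (card-∪+∩ A B)) (sym (+-suc _ _))
card-∪+∩ (false ∷ A) (false ∷ B) = card-∪+∩ A B

card-split : ∀ {n} (A B : Subset n) → ∣ A ∣ ≡ ∣ A ∩ B ∣ + ∣ A ∩ ∁ B ∣
card-split [] [] = refl
card-split (true ∷ A) (true ∷ B) = cong suc (card-split A B)
card-split (true ∷ A) (false ∷ B) = trans (cong suc (card-split A B)) (sym (+-suc _ _))
card-split (false ∷ A) (true ∷ B) = card-split A B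
card-split (false ∷ A) (false ∷ B) = card-split A B

⊆-card-≥⇒⊇ : ∀ {n} (A B : Subset n) → A ⊆ B → ∣ B ∣ ≤ ∣ A ∣ → B ⊆ A
⊆-card-≥⇒⊇ (true ∷ A) (true ∷ B) A⊆B _ here = here
⊆-card-≥⇒⊇ (true ∷ A) (true ∷ B) A⊆B size (there x∈B) =
  there (⊆-card-≥⇒⊇ A B (drop-∷-⊆ A⊆B) (s≤s⁻¹ size) x∈B)
⊆-card-≥⇒⊇ (true ∷ A) (false ∷ B) A⊆B _ _ with A⊆B here
... | ()
⊆-card-≥⇒⊇ (false ∷ A) (true ∷ B) A⊆B size _ =
  ⊥-elim (<⇒≱ size (p⊆q⇒∣p∣≤∣q∣ (drop-∷-⊆ A⊆B)))
⊆-card-≥⇒⊇ (false ∷ A) (false ∷ B) A⊆B size (there x∈B) =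
  there (⊆-card-≥⇒⊇ A B (drop-∷-⊆ A⊆B) size x∈B)

card-empty : ∀ {n} (A : Subset n) → (∀ x → x ∉ A) → ∣ A ∣ ≡ 0
card-empty {n} A empty =
  n≤0⇒n≡0 (subst (∣ A ∣ ≤_) (∣⊥∣≡0 n) (p⊆q⇒∣p∣≤∣q∣ {q = ⊥} (λ {x} x∈A → ⊥-elim (empty x x∈A))))

card-∪-disjoint : ∀ {n} (A B : Subset n) → (∀ x → x ∈ A → x ∉ B) → ∣ A ∪ B ∣ ≡ ∣ A ∣ + ∣ B ∣
card-∪-disjoint A B disjoint = begin
  ∣ A ∪ B ∣              ≡⟨ sym (+-identityʳ _) ⟩
  ∣ A ∪ B ∣ + 0          ≡⟨ cong (∣ A ∪ B ∣ +_) (sym (card-empty (A ∩ B) no-common)) ⟩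
  ∣ A ∪ B ∣ + ∣ A ∩ B ∣  ≡⟨ card-∪+∩ A B ⟩
  ∣ A ∣ + ∣ B ∣          ∎
  where
  open ≡-Reasoning
  no-common : ∀ x → x ∉ A ∩ B
  no-common x x∈A∩B = let (x∈A , x∈B) = x∈p∩q⁻ A B x∈A∩B in disjoint x x∈A x∈B

∪-⊆ : ∀ {n} (A B : Subset n) {C} → A ⊆ C → B ⊆ C → A ∪ B ⊆ C
∪-⊆ A B A⊆C B⊆C x∈A∪B with x∈p∪q⁻ A B x∈A∪B
... | inj₁ x∈A = A⊆C x∈A
... | inj₂ x∈B = B⊆C x∈B

card-∪≤ : ∀ {n} (A B : Subset n) → ∣ A ∪ B ∣ ≤ ∣ A ∣ + ∣ B ∣
card-∪≤ A B = subst (∣ A ∪ B ∣ ≤_) (card-∪+∩ A B) (m≤m+n _ _)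

cancel-≤ : ∀ c {a b x y} → a ≤ b → a ≡ c + x → b ≡ c + y → x ≤ y
cancel-≤ c {x = x} {y} a≤b refl refl = +-cancelˡ-≤ c x y a≤b

surplus-≤⇒ : ∀ a b c d → (ι a - ι b) ≤ℤ (ι c - ι d) → a + d ≤ c + b
surplus-≤⇒ a b c d le = ℤP.drop‿+≤+ (subst₂ _≤ℤ_ shift-l shift-r (ℤP.+-monoˡ-≤ (ι b +ℤ ι d) le))
  where
  add-back : ∀ (x y z : ℤ) → (x - y) +ℤ (y +ℤ z) ≡ x +ℤ z
  add-back = ℤ-solve-∀
  shift-l : (ι a - ι b) +ℤ (ι b +ℤ ι d) ≡ ι (a + d)
  shift-l = trans (add-back (ι a) (ι b) (ι d)) (sym (ℤP.pos-+ a d))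
  shift-r : (ι c - ι d) +ℤ (ι b +ℤ ι d) ≡ ι (c + b)
  shift-r = trans (cong ((ι c - ι d) +ℤ_) (ℤP.+-comm (ι b) (ι d)))
                  (trans (add-back (ι c) (ι d) (ι b)) (sym (ℤP.pos-+ c b)))

surplus-≤⇐ : ∀ a b c d → a + d ≤ c + b → (ι a - ι b) ≤ℤ (ι c - ι d)
surplus-≤⇐ a b c d le =
  subst₂ _≤ℤ_ shift-l shift-r (ℤP.+-monoˡ-≤ (- (ι b +ℤ ι d)) (+≤+ le))
  where
  sub-both : ∀ (x y z : ℤ) → x - y ≡ (x +ℤ z) - (y +ℤ z)
  sub-both = ℤ-solve-∀
  shift-l : ι (a + d) - (ι b +ℤ ι d) ≡ ι a - ι b
  shift-l = trans (cong (λ z → z - (ι b +ℤ ι d)) (ℤP.pos-+ a d)) (sym (sub-both (ι a) (ι b) (ι d)))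
  shift-r : ι (c + b) - (ι b +ℤ ι d) ≡ ι c - ι d
  shift-r = trans (cong₂ _-_ (ℤP.pos-+ c b) (ℤP.+-comm (ι b) (ι d))) (sym (sub-both (ι c) (ι d) (ι b)))

does-true⇒ : ∀ {P : Set} (p? : Dec P) → does p? ≡ true → P
does-true⇒ (yes p) _ = p
does-true⇒ (no _) ()

subsets : ∀ n → List (Subset n)
subsets zero = [] L.∷ L.[]
subsets (suc n) = map (true ∷_) (subsets n) ++ map (false ∷_) (subsets n)

∈-subsets : ∀ {n} (A : Subset n) → A ∈ᴸ subsets n
∈-subsets [] = here refl
∈-subsets (true ∷ A) = ∈-++⁺ˡ (∈-map⁺ (true ∷_) (∈-subsets A))
∈-subsets (false ∷ A) = ∈-++⁺ʳ (map (true ∷_) (subsets _)) (∈-map⁺ (false ∷_) (∈-subsets A))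

module _ {n : ℕ} (G : Graph n) where

  adjacent-sym : ∀ {u v} → E G u v ≡ true → E G v u ≡ true
  adjacent-sym {u} {v} uv = trans (E-sym G v u) uv

  ∈N⁺ : ∀ {J u v} → u ∈ J → E G u v ≡ true → v ∈ N G J
  ∈N⁺ {J} {u} {v} u∈J uv = lookup⇒[]= v (N G J)
    (trans (lookup∘tabulate _ v) (dec-true (any? _) (u , u∈J , uv)))

  ∈N⁻ : ∀ {J v} → v ∈ N G J → ∃ λ u → u ∈ J × E G u v ≡ true
  ∈N⁻ {J} {v} v∈N =
    does-true⇒ (any? _) (trans (sym (lookup∘tabulate _ v)) ([]=⇒lookup v∈N))

  N-mono : ∀ {A B} → A ⊆ B → N G A ⊆ N G B
  N-mono A⊆B v∈N with ∈N⁻ v∈N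
  ... | u , u∈A , uv = ∈N⁺ (A⊆B u∈A) uv

  N-∪ : ∀ A B → N G (A ∪ B) ⊆ N G A ∪ N G B
  N-∪ A B v∈N with ∈N⁻ v∈N
  ... | u , u∈A∪B , uv with x∈p∪q⁻ A B u∈A∪B
  ...   | inj₁ u∈A = x∈p∪q⁺ (inj₁ (∈N⁺ u∈A uv))
  ...   | inj₂ u∈B = x∈p∪q⁺ (inj₂ (∈N⁺ u∈B uv))

  N-∩ : ∀ A B → N G (A ∩ B) ⊆ N G A ∩ N G B
  N-∩ A B v∈N with ∈N⁻ v∈N
  ... | u , u∈A∩B , uv = let (u∈A , u∈B) = x∈p∩q⁻ A B u∈A∩B in x∈p∩q⁺ (∈N⁺ u∈A uv , ∈N⁺ u∈B uv)

  _∖N_ : Subset n → Subset n → Subset n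
  A ∖N B = A ∩ ∁ (N G B)

  N-avoiding : ∀ I Q → N G (I ∖N Q) ⊆ N G I ∩ ∁ Q
  N-avoiding I Q v∈N with ∈N⁻ v∈N
  ... | u , u∈I′ , uv = let (u∈I , u∉NQ) = x∈p∩q⁻ I (∁ (N G Q)) u∈I′ in
    x∈p∩q⁺ (∈N⁺ u∈I uv , x∉p⇒x∈∁p (λ v∈Q → x∈∁p⇒x∉p u∉NQ (∈N⁺ v∈Q (adjacent-sym uv))))

  independent-⊆ : ∀ {A B} → A ⊆ B → Independent G B → Independent G A
  independent-⊆ A⊆B indB u v u∈A v∈A = indB u v (A⊆B u∈A) (A⊆B v∈A)

  independent-∪ : ∀ A B → Independent G A → Independent G B →
    (∀ u v → u ∈ A → v ∈ B → E G u v ≡ false) → Independent G (A ∪ B)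
  independent-∪ A B indA indB across u v u∈ v∈ with x∈p∪q⁻ A B u∈ | x∈p∪q⁻ A B v∈
  ... | inj₁ u∈A | inj₁ v∈A = indA u v u∈A v∈A
  ... | inj₁ u∈A | inj₂ v∈B = across u v u∈A v∈B
  ... | inj₂ u∈B | inj₁ v∈A = trans (E-sym G u v) (across v u v∈A u∈B)
  ... | inj₂ u∈B | inj₂ v∈B = indB u v u∈B v∈B

  independent⇒non-adjacent : ∀ {A u v} → Independent G A → u ∈ A → v ∈ A → E G u v ≢ true
  independent⇒non-adjacent indA u∈A v∈A uv with trans (sym uv) (indA _ _ u∈A v∈A)
  ... | ()

  non-adjacent-outside-N : ∀ {A u v} → u ∈ A → v ∉ N G A → E G u v ≡ false
  non-adjacent-outside-N u∈A v∉N = ¬-not (λ uv → v∉N (∈N⁺ u∈A uv))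

  independent? : ∀ J → Dec (Independent G J)
  independent? J =
    all? (λ u → all? (λ v → (u ∈? J) →-dec ((v ∈? J) →-dec (E G u v B.≟ false))))

  -- K ≼ J says σ(K) ≤ σ(J) for the surplus σ(J) = |J| - |N(J)|, stated in ℕ.
  _≼_ : Subset n → Subset n → Set
  K ≼ J = ∣ K ∣ + ∣ N G J ∣ ≤ ∣ J ∣ + ∣ N G K ∣

  -- Critical independent sets of G and maximum ones, in ℕ form; they agree with
  -- Critical G ⊤ and MaxCritical G ⊤ (see critical⇒Crit and maxCritical⇒MaxCrit).
  Crit : Subset n → Set
  Crit J = Independent G J × (∀ K → Independent G K → K ≼ J)

  MaxCrit : Subset n → Set
  MaxCrit J = Crit J × (∀ K → Crit K → ∣ K ∣ ≤ ∣ J ∣)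

  -- Deleting from I its vertices adjacent to Q lowers the surplus by at most
  -- |I ∩ N(Q)| - |N(I) ∩ Q|:  σ(I) + |N(I) ∩ Q| ≤ σ(I ∖N Q) + |I ∩ N(Q)|.
  surplus-after-deletion : ∀ I Q →
    ∣ I ∣ + ∣ N G I ∩ Q ∣ + ∣ N G (I ∖N Q) ∣ ≤ ∣ I ∖N Q ∣ + ∣ N G I ∣ + ∣ I ∩ N G Q ∣
  surplus-after-deletion I Q =
    linear (∣ I ∣) (∣ I ∩ N G Q ∣) (∣ I ∖N Q ∣) (∣ N G I ∩ Q ∣) (∣ N G I ∣) (∣ N G I ∩ ∁ Q ∣) (∣ N G (I ∖N Q) ∣)
      (card-split I (N G Q)) (card-split (N G I) Q) (p⊆q⇒∣p∣≤∣q∣ (N-avoiding I Q))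
    where
    linear : ∀ i r a p q s na → i ≡ r + a → q ≡ p + s → na ≤ s → i + p + na ≤ a + q + r
    linear _ r a p _ s na refl refl na≤s =
      ≤-trans (+-monoʳ-≤ (r + a + p) na≤s) (≤-reflexive (reorder r a p s))
      where
      reorder : ∀ r a p s → r + a + p + s ≡ a + (p + s) + r
      reorder = solve-∀

  -- Hall condition: for a critical I, every Q satisfies |N(I) ∩ Q| ≤ |I ∩ N(Q)|,
  -- because deleting I ∩ N(Q) from I cannot increase the surplus.
  hall : ∀ {I} → Crit I → ∀ Q → ∣ N G I ∩ Q ∣ ≤ ∣ I ∩ N G Q ∣
  hall {I} (indI , maximal) Q =
    linear (∣ I ∣) (∣ N G I ∩ Q ∣) (∣ N G (I ∖N Q) ∣) (∣ I ∖N Q ∣) (∣ N G I ∣) (∣ I ∩ N G Q ∣)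
      (surplus-after-deletion I Q) (maximal (I ∖N Q) (independent-⊆ (p∩q⊆p I _) indI))
    where
    linear : ∀ i p na a q r → i + p + na ≤ a + q + r → a + q ≤ i + na → p ≤ r
    linear i p na a q r h₁ h₂ =
      cancel-≤ (i + na + a + q) (+-mono-≤ h₁ h₂) (e₁ i p na a q) (e₂ i na a q r)
      where
      e₁ : ∀ i p na a q → i + p + na + (a + q) ≡ i + na + a + q + p
      e₁ = solve-∀
      e₂ : ∀ i na a q r → a + q + r + (i + na) ≡ i + na + a + q + r
      e₂ = solve-∀

  hall′ : ∀ {I} → Crit I → ∀ Q → ∣ Q ∩ N G I ∣ ≤ ∣ N G Q ∩ I ∣
  hall′ {I} critI Q =
    subst₂ _≤_ (cong ∣_∣ (∩-comm (N G I) Q)) (cong ∣_∣ (∩-comm I (N G Q))) (hall critI Q)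

  -- For critical I and J, the vertices of I not adjacent to J form a critical set:
  -- by Hall's condition for J, deleting I ∩ N(J) does not lower the surplus of I.
  crit-∖N : ∀ {I J} → Crit I → Crit J → Crit (I ∖N J)
  crit-∖N {I} {J} (indI , maximal) critJ = independent-⊆ (p∩q⊆p I _) indI , λ K indK →
    linear (∣ K ∣) (∣ N G I ∣) (∣ I ∣) (∣ N G K ∣) (∣ N G I ∩ J ∣) (∣ N G (I ∖N J) ∣) (∣ I ∖N J ∣) (∣ I ∩ N G J ∣)
      (maximal K indK) (surplus-after-deletion I J) (hall′ critJ I)
    where
    linear : ∀ k ni i nk t na a s → k + ni ≤ i + nk → i + t + na ≤ a + ni + s → s ≤ t → k + na ≤ a + nk
    linear k ni i nk t na a s h₁ h₂ h₃ =
      cancel-≤ (ni + i + t + s) (+-mono-≤ (+-mono-≤ h₁ h₂) h₃) (e₁ k ni i t na s) (e₂ i nk a ni s t)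
      where
      e₁ : ∀ k ni i t na s → k + ni + (i + t + na) + s ≡ ni + i + t + s + (k + na)
      e₁ = solve-∀
      e₂ : ∀ i nk a ni s t → i + nk + (a + ni + s) + t ≡ ni + i + t + s + (a + nk)
      e₂ = solve-∀

  -- The union of two critical sets is critical when it is independent: this is
  -- submodularity of |N(·)| combined with the criticality of A and of B.
  crit-∪ : ∀ {A B} → Crit A → Crit B → Independent G (A ∪ B) → Crit (A ∪ B)
  crit-∪ {A} {B} (indA , maxA) (_ , maxB) indA∪B = indA∪B , λ K indK →
    linear (∣ K ∣) (∣ N G A ∣) (∣ A ∣) (∣ N G K ∣) (∣ A ∩ B ∣) (∣ N G B ∣) (∣ B ∣) (∣ N G (A ∩ B) ∣) (∣ A ∪ B ∣)
      (∣ N G A ∪ N G B ∣) (∣ N G A ∩ N G B ∣) (∣ N G (A ∪ B) ∣)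
      (maxA K indK) (maxB (A ∩ B) (independent-⊆ (p∩q⊆p A B) indA))
      (card-∪+∩ A B) (card-∪+∩ (N G A) (N G B))
      (p⊆q⇒∣p∣≤∣q∣ (N-∪ A B)) (p⊆q⇒∣p∣≤∣q∣ (N-∩ A B))
    where
    linear : ∀ k na a nk ab nb b nab u nu nn nU →
      k + na ≤ a + nk → ab + nb ≤ b + nab → u + ab ≡ a + b → nu + nn ≡ na + nb →
      nU ≤ nu → nab ≤ nn → k + nU ≤ u + nk
    linear k na a nk ab nb b nab u nu nn nU h₁ h₂ h₃ h₄ h₅ h₆ =
      cancel-≤ (na + ab + nb + a + b + nu + nn + nab)
        (+-mono-≤ (+-mono-≤ (+-mono-≤ (+-mono-≤ (+-mono-≤ h₁ h₂) (≤-reflexive (sym h₃)))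
                                       (≤-reflexive h₄)) h₅) h₆)
        (e₁ k na ab nb a b nu nn nU nab) (e₂ a nk b nab u ab na nb nu nn)
      where
      e₁ : ∀ k na ab nb a b nu nn nU nab →
        k + na + (ab + nb) + (a + b) + (nu + nn) + nU + nab ≡ na + ab + nb + a + b + nu + nn + nab + (k + nU)
      e₁ = solve-∀
      e₂ : ∀ a nk b nab u ab na nb nu nn →
        a + nk + (b + nab) + (u + ab) + (na + nb) + nu + nn ≡ na + ab + nb + a + b + nu + nn + nab + (u + nk)
      e₂ = solve-∀

  -- If I is a maximum critical set and J is critical, then every vertex of J
  -- without a neighbour in I already lies in I: otherwise I ∪ (J ∖N I) would be
  -- a larger critical independent set.
  absorbed : ∀ {I J} → MaxCrit I → Crit J → J ∖N I ⊆ I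
  absorbed {I} {J} (critI , largest) critJ v∈J′ =
    ⊆-card-≥⇒⊇ I (I ∪ J′) (p⊆p∪q J′) (largest (I ∪ J′) (crit-∪ critI critJ′ independent))
      (q⊆p∪q I J′ v∈J′)
    where
    J′ : Subset n
    J′ = J ∖N I
    critJ′ : Crit J′
    critJ′ = crit-∖N critJ critI
    independent : Independent G (I ∪ J′)
    independent = independent-∪ I J′ (proj₁ critI) (proj₁ critJ′) λ u v u∈I v∈J′ →
      non-adjacent-outside-N u∈I (x∈∁p⇒x∉p (proj₂ (x∈p∩q⁻ J _ v∈J′)))

  closure-⊆ : ∀ {I J} → MaxCrit I → Crit J → J ∪ N G J ⊆ I ∪ N G I
  closure-⊆ {I} {J} maxI@(critI , _) critJ = ∪-⊆ J (N G J) J⊆ NJ⊆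
    where
    J⊆ : J ⊆ I ∪ N G I
    J⊆ {v} v∈J with v ∈? N G I
    ... | yes v∈NI = x∈p∪q⁺ (inj₂ v∈NI)
    ... | no v∉NI = x∈p∪q⁺ (inj₁ (absorbed maxI critJ (x∈p∩q⁺ (v∈J , x∉p⇒x∈∁p v∉NI))))

    -- Criticality of J against J ∖N I, together with Hall's condition for I,
    -- bounds the part of N(J) outside I by |N(J ∖N I)|.
    outside-bound : ∣ N G J ∩ ∁ I ∣ ≤ ∣ N G (J ∖N I) ∣
    outside-bound =
      linear (∣ J ∖N I ∣) (∣ N G J ∣) (∣ J ∣) (∣ N G (J ∖N I) ∣) (∣ J ∩ N G I ∣) (∣ N G J ∩ I ∣) (∣ N G J ∩ ∁ I ∣)
        (proj₂ critJ (J ∖N I) (proj₁ (crit-∖N critJ critI)))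
        (card-split J (N G I)) (card-split (N G J) I) (hall′ critI J)
      where
      linear : ∀ b nJ j nb s p q → b + nJ ≤ j + nb → j ≡ s + b → nJ ≡ p + q → s ≤ p → q ≤ nb
      linear b _ _ nb s p q h₁ refl refl h₂ =
        cancel-≤ (b + p + s) (+-mono-≤ h₁ h₂) (e₁ b p q s) (e₂ s b nb p)
        where
        e₁ : ∀ b p q s → b + (p + q) + s ≡ b + p + s + q
        e₁ = solve-∀
        e₂ : ∀ s b nb p → s + b + nb + p ≡ b + p + s + nb
        e₂ = solve-∀

    NJ⊆ : N G J ⊆ I ∪ N G I
    NJ⊆ {v} v∈NJ with v ∈? I
    ... | yes v∈I = x∈p∪q⁺ (inj₁ v∈I)
    ... | no v∉I = x∈p∪q⁺ (inj₂ (N-mono (absorbed maxI critJ)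
      (⊆-card-≥⇒⊇ (N G (J ∖N I)) (N G J ∩ ∁ I) (N-avoiding J I) outside-bound
        (x∈p∩q⁺ (v∈NJ , x∉p⇒x∈∁p v∉I)))))

  independent-⊥ : Independent G ⊥
  independent-⊥ u v u∈⊥ = ⊥-elim (∉⊥ u∈⊥)

  N-⊥ : ∀ S → ∣ NIn G S ⊥ ∣ ≡ 0
  N-⊥ S = card-empty (NIn G S ⊥) λ v v∈N → ∉⊥ (proj₁ (proj₂ (∈N⁻ (proj₁ (x∈p∩q⁻ (N G ⊥) S v∈N)))))

  ≤-surplus-⊥ : ∀ S K → ∣ K ∣ ≤ ∣ NIn G S K ∣ → surplus G S K ≤ℤ surplus G S ⊥
  ≤-surplus-⊥ S K small = surplus-≤⇐ (∣ K ∣) (∣ NIn G S K ∣) (∣ ⊥ {n = n} ∣) (∣ NIn G S ⊥ ∣)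
    (subst₂ (λ a b → ∣ K ∣ + a ≤ b + ∣ NIn G S K ∣) (sym (N-⊥ S)) (sym (∣⊥∣≡0 n))
      (subst (_≤ ∣ NIn G S K ∣) (sym (+-identityʳ ∣ K ∣)) small))

  surplus-⊥-≤ : ∀ S K → surplus G S ⊥ ≤ℤ surplus G S K → ∣ NIn G S K ∣ ≤ ∣ K ∣
  surplus-⊥-≤ S K large = subst (∣ NIn G S K ∣ ≤_) (+-identityʳ ∣ K ∣)
    (subst₂ (λ a b → a + ∣ NIn G S K ∣ ≤ ∣ K ∣ + b) (∣⊥∣≡0 n) (N-⊥ S)
      (surplus-≤⇒ (∣ ⊥ {n = n} ∣) (∣ NIn G S ⊥ ∣) (∣ K ∣) (∣ NIn G S K ∣) large))

  surplus-≤⇒≼ : ∀ K J → surplus G ⊤ K ≤ℤ surplus G ⊤ J → K ≼ J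
  surplus-≤⇒≼ K J le = subst₂ (λ a b → ∣ K ∣ + a ≤ ∣ J ∣ + b)
    (cong ∣_∣ (∩-identityʳ (N G J))) (cong ∣_∣ (∩-identityʳ (N G K)))
    (surplus-≤⇒ (∣ K ∣) (∣ NIn G ⊤ K ∣) (∣ J ∣) (∣ NIn G ⊤ J ∣) le)

  ≼⇒surplus-≤ : ∀ K J → K ≼ J → surplus G ⊤ K ≤ℤ surplus G ⊤ J
  ≼⇒surplus-≤ K J K≼J = surplus-≤⇐ (∣ K ∣) (∣ NIn G ⊤ K ∣) (∣ J ∣) (∣ NIn G ⊤ J ∣)
    (subst₂ (λ a b → ∣ K ∣ + a ≤ ∣ J ∣ + b) (cong ∣_∣ (sym (∩-identityʳ (N G J)))) (cong ∣_∣ (sym (∩-identityʳ (N G K)))) K≼J)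

  critical⇒Crit : ∀ {J} → Critical G ⊤ J → Crit J
  critical⇒Crit {J} ((_ , indJ) , maximal) =
    indJ , λ K indK → surplus-≤⇒≼ K J (maximal K ((λ _ → ∈⊤) , indK))

  Crit⇒critical : ∀ {J} → Crit J → Critical G ⊤ J
  Crit⇒critical {J} (indJ , maximal) =
    ((λ _ → ∈⊤) , indJ) , λ K indK → ≼⇒surplus-≤ K J (maximal K (proj₂ indK))

  maxCritical⇒MaxCrit : ∀ {J} → MaxCritical G ⊤ J → MaxCrit J
  maxCritical⇒MaxCrit (critJ , largest) =
    critical⇒Crit critJ , λ K critK → largest K (Crit⇒critical critK)

  -- Among the finitely many independent sets, first maximise the surplus, then
  -- maximise the size among the sets of maximum surplus.
  maximum-critical-exists : ∃ (MaxCritical G ⊤)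
  maximum-critical-exists =
    I , (((λ _ → ∈⊤) , proj₁ I-best) , I-critical) , I-largest
    where
    σ : Subset n → ℤ
    σ = surplus G ⊤

    independents : List (Subset n)
    independents = filter independent? (subsets n)

    J₀ : Subset n
    J₀ = ℤ-Extrema.argmax σ ⊥ independents

    J₀-independent : Independent G J₀
    J₀-independent = ℤ-Extrema.argmax-all σ independent-⊥ (all-filter independent? (subsets n))

    J₀-maximal : ∀ K → Independent G K → σ K ≤ℤ σ J₀
    J₀-maximal K indK = All.lookup (ℤ-Extrema.f[xs]≤f[argmax] ⊥ independents)
      (∈-filter⁺ independent? (∈-subsets K) indK)

    Best : Subset n → Set
    Best K = Independent G K × σ J₀ ≤ℤ σ K

    best? : ∀ K → Dec (Best K)
    best? K = independent? K ×-dec (σ J₀ ≤ℤ? σ K)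

    I : Subset n
    I = ℕ-Extrema.argmax ∣_∣ J₀ (filter best? (subsets n))

    I-best : Best I
    I-best = ℕ-Extrema.argmax-all ∣_∣ (J₀-independent , ℤP.≤-refl) (all-filter best? (subsets n))

    I-critical : ∀ K → IndepIn G ⊤ K → σ K ≤ℤ σ I
    I-critical K (_ , indK) = ℤP.≤-trans (J₀-maximal K indK) (proj₂ I-best)

    I-largest : ∀ K → Critical G ⊤ K → ∣ K ∣ ≤ ∣ I ∣
    I-largest K ((_ , indK) , maximal) =
      All.lookup (ℕ-Extrema.f[xs]≤f[argmax] J₀ (filter best? (subsets n)))
        (∈-filter⁺ best? (∈-subsets K) (indK , maximal J₀ ((λ _ → ∈⊤) , J₀-independent)))

  module Decomposition-at {I : Subset n} (maxI : MaxCrit I) where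

    critI : Crit I
    critI = proj₁ maxI

    indI : Independent G I
    indI = proj₁ critI

    X : Subset n
    X = I ∪ N G I

    X∖I⊆N : ∀ {K} → K ⊆ X → K ∩ ∁ I ⊆ N G I ∩ K
    X∖I⊆N {K} K⊆X {v} v∈K∖I with x∈p∩q⁻ K (∁ I) v∈K∖I
    ... | v∈K , v∉I with x∈p∪q⁻ I (N G I) (K⊆X v∈K)
    ...   | inj₁ v∈I = ⊥-elim (x∈∁p⇒x∉p v∉I v∈I)
    ...   | inj₂ v∈NI = x∈p∩q⁺ (v∈NI , v∈K)

    -- Every independent set K of G[X] is at most as large as I: K ∩ I avoids
    -- N(K), and by Hall's condition K ∖ I ⊆ N(I) is no larger than I ∩ N(K).
    independent-in-X-bound : ∀ K → K ⊆ X → Independent G K → ∣ K ∣ ≤ ∣ I ∣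
    independent-in-X-bound K K⊆X indK = begin
      ∣ K ∣                       ≡⟨ card-split K I ⟩
      ∣ K ∩ I ∣ + ∣ K ∩ ∁ I ∣     ≤⟨ +-mono-≤ (p⊆q⇒∣p∣≤∣q∣ K∩I⊆I∖NK)
                                      (≤-trans (p⊆q⇒∣p∣≤∣q∣ (X∖I⊆N K⊆X)) (hall critI K)) ⟩
      ∣ I ∖N K ∣ + ∣ I ∩ N G K ∣  ≡⟨ +-comm (∣ I ∖N K ∣) _ ⟩
      ∣ I ∩ N G K ∣ + ∣ I ∖N K ∣  ≡⟨ sym (card-split I (N G K)) ⟩
      ∣ I ∣                       ∎
      where
      open ≤-Reasoning
      K∩I⊆I∖NK : K ∩ I ⊆ I ∖N K
      K∩I⊆I∖NK v∈K∩I = let (v∈K , v∈I) = x∈p∩q⁻ K I v∈K∩I in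
        x∈p∩q⁺ (v∈I , x∉p⇒x∈∁p λ v∈NK → let (u , u∈K , uv) = ∈N⁻ v∈NK in
          independent⇒non-adjacent indK u∈K v∈K uv)

    -- I has maximum surplus in G[X]: compare K ∩ I with I by criticality, and
    -- match K ∖ I into the part of I adjacent to it, which is disjoint from N(K ∩ I).
    critical-in-X : ∀ K → K ⊆ X → Independent G K → ∣ K ∣ + ∣ NIn G X I ∣ ≤ ∣ I ∣ + ∣ NIn G X K ∣
    critical-in-X K K⊆X indK =
      linear (∣ K ∣) (∣ K ∩ I ∣) (∣ K ∩ ∁ I ∣) (∣ N G I ∩ X ∣) (∣ N G I ∣) (∣ I ∣) (∣ N G (K ∩ I) ∣)
        (∣ N G I ∩ (K ∩ ∁ I) ∣) (∣ I ∩ N G (K ∩ ∁ I) ∣) (∣ N G (K ∩ I) ∪ (I ∩ N G (K ∩ ∁ I)) ∣) (∣ N G K ∩ X ∣)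
        (card-split K I) (p⊆q⇒∣p∣≤∣q∣ (p∩q⊆p (N G I) X))
        (proj₂ critI (K ∩ I) (independent-⊆ (p∩q⊆p K I) indK))
        (p⊆q⇒∣p∣≤∣q∣ K∖I⊆N) (hall critI (K ∩ ∁ I)) (card-∪-disjoint _ _ disjoint) (p⊆q⇒∣p∣≤∣q∣ ⊆N∩X)
      where
      K∖I⊆N : K ∩ ∁ I ⊆ N G I ∩ (K ∩ ∁ I)
      K∖I⊆N v∈K∖I = x∈p∩q⁺ (proj₁ (x∈p∩q⁻ (N G I) K (X∖I⊆N K⊆X v∈K∖I)) , v∈K∖I)
      disjoint : ∀ v → v ∈ N G (K ∩ I) → v ∉ I ∩ N G (K ∩ ∁ I)
      disjoint v v∈N v∈I′ with ∈N⁻ v∈N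
      ... | u , u∈K∩I , uv = independent⇒non-adjacent indI (proj₂ (x∈p∩q⁻ K I u∈K∩I)) (proj₁ (x∈p∩q⁻ I _ v∈I′)) uv
      ⊆N∩X : N G (K ∩ I) ∪ (I ∩ N G (K ∩ ∁ I)) ⊆ N G K ∩ X
      ⊆N∩X = ∪-⊆ _ _
        (λ v∈N → x∈p∩q⁺ (N-mono (p∩q⊆p K I) v∈N , q⊆p∪q I (N G I) (N-mono (p∩q⊆q K I) v∈N)))
        (λ v∈I′ → let (v∈I , v∈N) = x∈p∩q⁻ I _ v∈I′ in x∈p∩q⁺ (N-mono (p∩q⊆p K (∁ I)) v∈N , p⊆p∪q (N G I) v∈I))
      linear : ∀ k k₁ k₂ nix ni i nk₁ t r u nkx → k ≡ k₁ + k₂ → nix ≤ ni → k₁ + ni ≤ i + nk₁ →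
        k₂ ≤ t → t ≤ r → u ≡ nk₁ + r → u ≤ nkx → k + nix ≤ i + nkx
      linear _ k₁ k₂ nix ni i nk₁ t r _ nkx refl h₁ h₂ h₃ h₄ refl h₅ =
        cancel-≤ (ni + nk₁ + t + r) (+-mono-≤ (+-mono-≤ (+-mono-≤ (+-mono-≤ h₁ h₂) h₃) h₄) h₅)
          (e₁ nix k₁ ni k₂ t nk₁ r) (e₂ ni i nk₁ t r nkx)
        where
        e₁ : ∀ nix k₁ ni k₂ t nk₁ r → nix + (k₁ + ni) + k₂ + t + (nk₁ + r) ≡ ni + nk₁ + t + r + (k₁ + k₂ + nix)
        e₁ = solve-∀
        e₂ : ∀ ni i nk₁ t r nkx → ni + (i + nk₁) + t + r + nkx ≡ ni + nk₁ + t + r + (i + nkx)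
        e₂ = solve-∀

    maxCritical-in-X : MaxCritical G X I
    maxCritical-in-X =
      ((p⊆p∪q (N G I) , indI) , λ K (K⊆X , indK) →
        surplus-≤⇐ (∣ K ∣) (∣ NIn G X K ∣) (∣ I ∣) (∣ NIn G X I ∣) (critical-in-X K K⊆X indK))
      , λ K ((K⊆X , indK) , _) → independent-in-X-bound K K⊆X indK

    totally-reducible : ∀ k → IsAlpha G X k → IsCritAlpha G X k
    totally-reducible k ((J , (J⊆X , indJ) , |J|≡k) , maximum) =
      I , maxCritical-in-X ,
      ≤-antisym (maximum I (p⊆p∪q (N G I) , indI)) (subst (_≤ ∣ I ∣) |J|≡k (independent-in-X-bound J J⊆X indJ))

    -- An independent set K of G[X^c] can be added to I; comparing I ∪ K with I
    -- shows that K has non-positive surplus in G[X^c], and zero surplus only if K = ∅.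
    module Outside {K : Subset n} (K⊆∁X : K ⊆ ∁ X) (indK : Independent G K) where

      K∉X : ∀ {v} → v ∈ K → v ∉ X
      K∉X v∈K = x∈∁p⇒x∉p (K⊆∁X v∈K)

      independent-I∪K : Independent G (I ∪ K)
      independent-I∪K = independent-∪ I K indI indK λ u v u∈I v∈K →
        non-adjacent-outside-N u∈I (λ v∈NI → K∉X v∈K (q⊆p∪q I (N G I) v∈NI))

      card-I∪K : ∣ I ∪ K ∣ ≡ ∣ I ∣ + ∣ K ∣
      card-I∪K = card-∪-disjoint I K λ v v∈I v∈K → K∉X v∈K (p⊆p∪q (N G I) v∈I)

      -- A neighbour of K inside X lies in N(I): it cannot lie in I, as K ∩ N(I) = ∅.
      N-I∪K : N G (I ∪ K) ⊆ N G I ∪ NIn G (∁ X) K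
      N-I∪K {v} v∈N with x∈p∪q⁻ (N G I) (N G K) (N-∪ I K v∈N)
      ... | inj₁ v∈NI = x∈p∪q⁺ (inj₁ v∈NI)
      ... | inj₂ v∈NK with v ∈? X
      ...   | no v∉X = x∈p∪q⁺ (inj₂ (x∈p∩q⁺ (v∈NK , x∉p⇒x∈∁p v∉X)))
      ...   | yes v∈X with x∈p∪q⁻ I (N G I) v∈X
      ...     | inj₂ v∈NI = x∈p∪q⁺ (inj₁ v∈NI)
      ...     | inj₁ v∈I = let (u , u∈K , uv) = ∈N⁻ v∈NK in
                  ⊥-elim (K∉X u∈K (q⊆p∪q I (N G I) (∈N⁺ v∈I (adjacent-sym uv))))

      card-N-I∪K : ∣ N G (I ∪ K) ∣ ≤ ∣ N G I ∣ + ∣ NIn G (∁ X) K ∣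
      card-N-I∪K = ≤-trans (p⊆q⇒∣p∣≤∣q∣ N-I∪K) (card-∪≤ (N G I) (NIn G (∁ X) K))

      non-positive : ∣ K ∣ ≤ ∣ NIn G (∁ X) K ∣
      non-positive =
        linear (∣ I ∪ K ∣) (∣ N G I ∣) (∣ I ∣) (∣ N G (I ∪ K) ∣) (∣ K ∣) (∣ NIn G (∁ X) K ∣)
          (proj₂ critI (I ∪ K) independent-I∪K) card-I∪K card-N-I∪K
        where
        linear : ∀ ik ni i nik k nk → ik + ni ≤ i + nik → ik ≡ i + k → nik ≤ ni + nk → k ≤ nk
        linear _ ni i nik k nk h₁ refl h₂ =
          cancel-≤ (i + ni + nik) (+-mono-≤ h₁ h₂) (e₁ i k ni nik) (e₂ i nik ni nk)
          where
          e₁ : ∀ i k ni nik → i + k + ni + nik ≡ i + ni + nik + k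
          e₁ = solve-∀
          e₂ : ∀ i nik ni nk → i + nik + (ni + nk) ≡ i + ni + nik + nk
          e₂ = solve-∀

      -- If K has zero surplus in G[X^c], then I ∪ K is critical in G, hence K = ∅.
      empty-if-zero-surplus : ∣ NIn G (∁ X) K ∣ ≤ ∣ K ∣ → ∣ K ∣ ≤ 0
      empty-if-zero-surplus nk≤k = +-cancelˡ-≤ (∣ I ∣) _ _ (begin
        ∣ I ∣ + ∣ K ∣  ≡⟨ sym card-I∪K ⟩
        ∣ I ∪ K ∣      ≤⟨ proj₂ maxI (I ∪ K) critical-I∪K ⟩
        ∣ I ∣          ≡⟨ sym (+-identityʳ _) ⟩
        ∣ I ∣ + 0      ∎)
        where
        open ≤-Reasoning
        critical-I∪K : Crit (I ∪ K)
        critical-I∪K = independent-I∪K , λ L indL →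
          linear (∣ L ∣) (∣ N G I ∣) (∣ I ∣) (∣ N G L ∣) (∣ N G (I ∪ K) ∣) (∣ NIn G (∁ X) K ∣) (∣ K ∣) (∣ I ∪ K ∣)
            (proj₂ critI L indL) card-N-I∪K nk≤k card-I∪K
          where
          linear : ∀ l ni i nl nik nk k ik → l + ni ≤ i + nl → nik ≤ ni + nk → nk ≤ k → ik ≡ i + k → l + nik ≤ ik + nl
          linear l ni i nl nik nk k _ h₁ h₂ h₃ refl =
            cancel-≤ (ni + nk) (+-mono-≤ (+-mono-≤ h₁ h₂) h₃) (e₁ l ni nik nk) (e₂ i nl ni nk k)
            where
            e₁ : ∀ l ni nik nk → l + ni + nik + nk ≡ ni + nk + (l + nik)
            e₁ = solve-∀
            e₂ : ∀ i nl ni nk k → i + nl + (ni + nk) + k ≡ ni + nk + (i + k + nl)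
            e₂ = solve-∀

    irreducible-complement : IsCritAlpha G (∁ X) 0
    irreducible-complement = ⊥ , (critical-⊥ , smallest) , ∣⊥∣≡0 n
      where
      critical-⊥ : Critical G (∁ X) ⊥
      critical-⊥ = (⊥⊆ , independent-⊥) , λ K (K⊆∁X , indK) →
        ≤-surplus-⊥ (∁ X) K (Outside.non-positive K⊆∁X indK)
      smallest : ∀ K → Critical G (∁ X) K → ∣ K ∣ ≤ ∣ ⊥ {n = n} ∣
      smallest K ((K⊆∁X , indK) , maximal) = subst (∣ K ∣ ≤_) (sym (∣⊥∣≡0 n))
        (Outside.empty-if-zero-surplus K⊆∁X indK (surplus-⊥-≤ (∁ X) K (maximal ⊥ (proj₁ critical-⊥))))

    -- Condition (1): α(G) = α(G[X]) + α(G[X^c]).  A maximum independent set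
    -- splits along X, and conversely I ∪ K is independent for any independent K of G[X^c].
    alpha-additive : ∀ a b c → IsAlpha G ⊤ a → IsAlpha G X b → IsAlpha G (∁ X) c → a ≡ b + c
    alpha-additive a b c ((M , (_ , indM) , |M|≡a) , maxG) ((J , (J⊆X , indJ) , |J|≡b) , maxX)
                         ((K , (K⊆∁X , indK) , |K|≡c) , max∁X) = ≤-antisym a≤b+c b+c≤a
      where
      open ≤-Reasoning
      a≤b+c : a ≤ b + c
      a≤b+c = begin
        a                          ≡⟨ sym |M|≡a ⟩
        ∣ M ∣                      ≡⟨ card-split M X ⟩
        ∣ M ∩ X ∣ + ∣ M ∩ ∁ X ∣    ≤⟨ +-mono-≤ (maxX (M ∩ X) (p∩q⊆q M X , independent-⊆ (p∩q⊆p M X) indM))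
                                               (max∁X (M ∩ ∁ X) (p∩q⊆q M (∁ X) , independent-⊆ (p∩q⊆p M (∁ X)) indM)) ⟩
        b + c                      ∎
      b+c≤a : b + c ≤ a
      b+c≤a = begin
        b + c                      ≡⟨ cong₂ _+_ (sym |J|≡b) (sym |K|≡c) ⟩
        ∣ J ∣ + ∣ K ∣              ≤⟨ +-monoˡ-≤ (∣ K ∣) (independent-in-X-bound J J⊆X indJ) ⟩
        ∣ I ∣ + ∣ K ∣              ≡⟨ sym (Outside.card-I∪K K⊆∁X indK) ⟩
        ∣ I ∪ K ∣                  ≤⟨ maxG (I ∪ K) ((λ _ → ∈⊤) , Outside.independent-I∪K K⊆∁X indK) ⟩
        a                          ∎

    closure-is-X : ∀ J → MaxCritical G ⊤ J → X ≡ J ∪ N G J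
    closure-is-X J maxJ = ⊆-antisym (closure-⊆ maxJ′ critI) (closure-⊆ maxI (proj₁ maxJ′))
      where
      maxJ′ : MaxCrit J
      maxJ′ = maxCritical⇒MaxCrit maxJ

    decomposition : Decomposition G X
    decomposition = alpha-additive , totally-reducible , irreducible-complement , closure-is-X

-- X = I ∪ N(I) for a maximum critical independent set I satisfies (1)-(4); any
-- Y satisfying (4) equals I ∪ N(I), so X is unique.
theorem2p4 : ∀ {n : ℕ} (G : Graph n) →
    ∃ λ (X : Subset n) → Decomposition G X × (∀ Y → Decomposition G Y → Y ≡ X)
theorem2p4 {n} G = X , decomposition , λ Y (_ , _ , _ , closure-is-Y) → closure-is-Y I maxI
  where
  I : Subset n
  I = proj₁ (maximum-critical-exists G)
  maxI : MaxCritical G ⊤ I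
  maxI = proj₂ (maximum-critical-exists G)
  open Decomposition-at G (maxCritical⇒MaxCrit G maxI)
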